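{- Let $N,M$ be positive integers. Let $A\subset\{0,\dots,N-1\}$ be spectral in $\mathbb{Z}_N$ with spectrum $\Lambda_1\subset\mathbb{Z}_N$, and suppose $\{A_a:a\in A\}$ are subsets of $\{0,\dots,M-1\}$ (viewed in $\mathbb{Z}_M$) that have a common spectrum $\Lambda_2$ in $\mathbb{Z}_M$. Then the set $\bigcup_{a\in A}(\{a\}\oplus NA_a)$ is spectral in $\mathbb{Z}_{NM}$ with spectrum $M\Lambda_1+\Lambda_2$.
   Context: A subset $X$ of $\mathbb{Z}_K$ is spectral with spectrum $\Lambda\subset\mathbb{Z}_K$ if $\#\Lambda=\#X$ and the matrix $\frac{1}{\sqrt{\#X}}\left(e^{2\pi i x\lambda/K}\right)_{x\in X,\lambda\in\Lambda}$ is unitary. $\{a\}\oplus NA_a=\{a+Nb:b\in A_a\}$. -}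

module Defs where

open import Level using (0ℓ)
open import Algebra.Bundles using (CommutativeRing)
open import Data.Nat as ℕ using (ℕ; zero; suc; NonZero)
open import Data.Nat.Properties using (m*n≢0)
open import Data.Nat.DivMod using (_mod_)
open import Data.Fin as Fin using (Fin; toℕ; _≟_)
open import Data.Fin.Subset using (Subset; ∣_∣; _∈_)
open import Data.Bool using (Bool; true; false; _∧_; _∨_; if_then_else_)
open import Data.Vec using (lookup; tabulate)
open import Data.Product using (_×_)
open import Data.Sum using (_⊎_)
open import Relation.Nullary using (¬_; ⌊_⌋)
open import Relation.Binary.PropositionalEquality using (_≡_; _≢_)

anyᵇ : ∀ m → (Fin m → Bool) → Bool
anyᵇ zero    p = false
anyᵇ (suc m) p = p Fin.zero ∨ anyᵇ m (λ i → p (Fin.suc i))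

[_]_ : ℕ → (K : ℕ) → .{{NonZero K}} → Fin K
[ n ] K = n mod K

module _ (R : CommutativeRing 0ℓ 0ℓ) where
  open CommutativeRing R

  pow : Carrier → ℕ → Carrier
  pow x zero    = 1#
  pow x (suc n) = x * pow x n

  natR : ℕ → Carrier
  natR zero    = 0#
  natR (suc n) = 1# + natR n

  ΣFin : ∀ K → (Fin K → Carrier) → Carrier
  ΣFin zero    f = 0#
  ΣFin (suc K) f = f Fin.zero + ΣFin K (λ i → f (Fin.suc i))

  ΣSub : ∀ {K} → Subset K → (Fin K → Carrier) → Carrier
  ΣSub {K} X f = ΣFin K (λ x → if lookup X x then f x else 0#)

  IsChar0Domain : Set
  IsChar0Domain = (¬ (1# ≈ 0#))
                × (∀ x y → x * y ≈ 0# → x ≈ 0# ⊎ y ≈ 0#)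
                × (∀ n → n ≢ 0 → ¬ (natR n ≈ 0#))

  -- ω is a primitive K-th root of unity (plays the role of e^{2πi/K})
  IsPrimitiveRoot : ℕ → Carrier → Set
  IsPrimitiveRoot K ω = (pow ω K ≈ 1#)
                      × (∀ d → 0 ℕ.< d → d ℕ.< K → ¬ (pow ω d ≈ 1#))

  -- X ⊆ ℤ_K is spectral with spectrum Λ (w.r.t. the root ω = e^{2πi/K}):
  -- #Λ = #X and the matrix U = (#X)^{-1/2} (ω^{xλ})_{x∈X,λ∈Λ} is unitary,
  -- written out as  #X · (U* U) = #X · I , where conj(ω^k) = ω^{K-k}:
  --   Σ_{x∈X} ω^{x(K-λ)} ω^{xλ'} = #X if λ = λ', and 0 otherwise.
  Spectral : (K : ℕ) → Carrier → Subset K → Subset K → Set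
  Spectral K ω X Λ =
    (∣ Λ ∣ ≡ ∣ X ∣)
    × (∀ λ₁ λ₂ → λ₁ ∈ Λ → λ₂ ∈ Λ →
        ΣSub X (λ x → pow ω (toℕ x ℕ.* (K ℕ.∸ toℕ λ₁)) * pow ω (toℕ x ℕ.* toℕ λ₂))
          ≈ (if ⌊ λ₁ ≟ λ₂ ⌋ then natR ∣ X ∣ else 0#))

bigUnion : ∀ N M .{{_ : NonZero N}} .{{_ : NonZero M}} →
           Subset N → (Fin N → Subset M) → Subset (N ℕ.* M)
bigUnion N M A Aa = tabulate λ z →
  anyᵇ N λ a → anyᵇ M λ b →
    lookup A a ∧ lookup (Aa a) b
      ∧ ⌊ ([ toℕ a ℕ.+ N ℕ.* toℕ b ] (N ℕ.* M)) {{m*n≢0 N M}} ≟ z ⌋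

sumSpectrum : ∀ N M .{{_ : NonZero N}} .{{_ : NonZero M}} →
              Subset N → Subset M → Subset (N ℕ.* M)
sumSpectrum N M Λ₁ Λ₂ = tabulate λ z →
  anyᵇ N λ l₁ → anyᵇ M λ l₂ →
    lookup Λ₁ l₁ ∧ lookup Λ₂ l₂
      ∧ ⌊ ([ M ℕ.* toℕ l₁ ℕ.+ toℕ l₂ ] (N ℕ.* M)) {{m*n≢0 N M}} ≟ z ⌋

{-# OPTIONS --safe #-}
-- Write x = a + N b with a ∈ A, b ∈ A_a, and λ = M l₁ + l₂ with l₁ ∈ Λ₁, l₂ ∈ Λ₂.
-- Since ζ^(NM) = 1, the character ζ^(xλ) splits as (ζ^M)^(a l₁) · ζ^(a l₂) · (ζ^N)^(b l₂),
-- so the (λ, λ′) entry of the Gram matrix of the union is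
--   Σ_{a ∈ A} (ζ^M)^(a(l₁′ - l₁)) ζ^(a(l₂′ - l₂)) Σ_{b ∈ A_a} (ζ^N)^(b(l₂′ - l₂)).
-- The inner sum is δ(l₂, l₂′) #Λ₂ because all A_a have spectrum Λ₂; this kills the twisting
-- middle factor, and the outer sum is then δ(l₁, l₁′) #A #Λ₂ because A has spectrum Λ₁.
-- The digit maps (a, b) ↦ a + N b and (l₁, l₂) ↦ M l₁ + l₂ are injective, which gives
-- #(union) = #A #Λ₂ = #Λ₁ #Λ₂ = #(M Λ₁ + Λ₂).
module Submission where

open import Defs
open import Level using (0ℓ)
open import Algebra.Bundles using (CommutativeMonoid; CommutativeRing)
open import Data.Bool using (Bool; true; false; T; _∧_; if_then_else_)
open import Data.Bool.Properties using (T-∨; T-≡)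
open import Data.Nat as ℕ using (ℕ; zero; suc; NonZero; _<_; _≤_; _∸_)
import Data.Nat.Properties as ℕ
open import Data.Nat.DivMod using (_%_; [m+kn]%n≡m%n; m<n⇒m%n≡m)
open import Data.Fin as Fin using (Fin; toℕ)
open import Data.Fin.Properties using (_≟_; 0≢1+n; suc-injective; toℕ<n; toℕ-injective; toℕ-fromℕ<)
open import Data.Fin.Subset using (Subset; ∣_∣; _∈_)
open import Data.Vec using ([]; _∷_; lookup; tabulate)
open import Data.Vec.Properties using (lookup∘tabulate; lookup⇒[]=; []=⇒lookup)
open import Data.Vec.Functional using (Vector)
open import Data.Product using (_×_; _,_; proj₁; proj₂; ∃; uncurry)
open import Data.Product.Properties using (,-injectiveˡ; ,-injectiveʳ)
open import Data.Sum using (inj₁; inj₂)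
open import Data.Empty using (⊥-elim)
open import Function using (_∘_; Equivalence)
open import Function.Definitions using (Injective)
open import Relation.Nullary using (Dec; ⌊_⌋; yes; no)
open import Relation.Nullary.Decidable using (⌊⌋-map′; isYes≗does; dec-true; dec-false)
import Relation.Binary.PropositionalEquality as ≡
open ≡ using (_≡_)

anyᵇ-witness : ∀ {m} (p : Fin m → Bool) → T (anyᵇ m p) → ∃ λ i → T (p i)
anyᵇ-witness {suc m} p t with Equivalence.to T-∨ t
... | inj₁ t₀ = Fin.zero , t₀
... | inj₂ t′ = let i , tᵢ = anyᵇ-witness (p ∘ Fin.suc) t′ in Fin.suc i , tᵢ

T-lookup⇒∈ : ∀ {n} (S : Subset n) {i} → T (lookup S i) → i ∈ S
T-lookup⇒∈ S {i} t = lookup⇒[]= i S (Equivalence.to T-≡ t)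

T-∧-∧-⌊⌋ : ∀ x y {A : Set} (d : Dec A) → T (x ∧ y ∧ ⌊ d ⌋) → T x × T y × A
T-∧-∧-⌊⌋ true  true  (yes a) _  = _ , _ , a
T-∧-∧-⌊⌋ true  true  (no _)  ()
T-∧-∧-⌊⌋ true  false _       ()
T-∧-∧-⌊⌋ false _     _       ()

⌊≟⌋-injective₂ : ∀ {m n k} (c : Fin m → Fin n → Fin k) → Injective _≡_ _≡_ (uncurry c) →
                 ∀ a b a′ b′ → ⌊ c a b ≟ c a′ b′ ⌋ ≡ ⌊ a ≟ a′ ⌋ ∧ ⌊ b ≟ b′ ⌋
⌊≟⌋-injective₂ c c-inj a b a′ b′ with a ≟ a′ | b ≟ b′
... | yes ≡.refl | yes ≡.refl = ≡.trans (isYes≗does _) (dec-true (c a b ≟ c a b) ≡.refl)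
... | yes ≡.refl | no b≢b′    = ≡.trans (isYes≗does _) (dec-false (c a b ≟ c a b′) (b≢b′ ∘ ,-injectiveʳ ∘ c-inj))
... | no a≢a′    | _          = ≡.trans (isYes≗does _) (dec-false (c a b ≟ c a′ b′) (a≢a′ ∘ ,-injectiveˡ ∘ c-inj))

module _ {m n k} (c : Fin m → Fin n → Fin k) (P : Subset m) (Q : Fin m → Subset n) where

  hitsᵇ : Fin k → Fin m → Fin n → Bool
  hitsᵇ z a b = lookup P a ∧ lookup (Q a) b ∧ ⌊ c a b ≟ z ⌋

  image : Subset k
  image = tabulate λ z → anyᵇ m λ a → anyᵇ n λ b → hitsᵇ z a b

  hitsᵇ⇒≡ : ∀ {z a b} → T (hitsᵇ z a b) → c a b ≡ z
  hitsᵇ⇒≡ {z} {a} {b} t = proj₂ (proj₂ (T-∧-∧-⌊⌋ (lookup P a) (lookup (Q a) b) (c a b ≟ z) t))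

  image-preimage : ∀ {z} → z ∈ image → ∃ λ a → ∃ λ b → a ∈ P × b ∈ Q a × c a b ≡ z
  image-preimage {z} z∈ with anyᵇ-witness (λ a → anyᵇ n (hitsᵇ z a)) z∈image
    where
    z∈image : T (anyᵇ m λ a → anyᵇ n (hitsᵇ z a))
    z∈image = Equivalence.from T-≡ (≡.trans (≡.sym (lookup∘tabulate _ z)) ([]=⇒lookup z∈))
  ... | a , ta with anyᵇ-witness (hitsᵇ z a) ta
  ... | b , tb with T-∧-∧-⌊⌋ (lookup P a) (lookup (Q a) b) (c a b ≟ z) tb
  ... | tP , tQ , e = a , b , T-lookup⇒∈ P tP , T-lookup⇒∈ (Q a) tQ , e

module IndicatorSums {c ℓ} (C : CommutativeMonoid c ℓ) where
  open CommutativeMonoid C renaming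
    (_∙_ to _+_; ε to 0#; ∙-congˡ to +-congˡ; identityˡ to +-identityˡ; identityʳ to +-identityʳ)
  open import Algebra.Properties.CommutativeMonoid.Sum C
  open import Relation.Binary.Reasoning.Setoid setoid

  when : Bool → Carrier → Carrier
  when b x = if b then x else 0#

  when-congᵀ : ∀ b {x y} → (T b → x ≈ y) → when b x ≈ when b y
  when-congᵀ true  x≈y = x≈y _
  when-congᵀ false x≈y = refl

  when-∧ : ∀ b b′ x → when (b ∧ b′) x ≡ when b (when b′ x)
  when-∧ true  b′ x = ≡.refl
  when-∧ false b′ x = ≡.refl

  when-≈0# : ∀ b {x} → (T b → x ≈ 0#) → when b x ≈ 0#
  when-≈0# true  x≈0 = x≈0 _
  when-≈0# false x≈0 = refl

  sum-when : ∀ {n} b (f : Vector Carrier n) → ∑[ i < n ] when b (f i) ≈ when b (sum f)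
  sum-when true  f = refl
  sum-when {n} false f = sum-replicate-zero n

  sum-delta : ∀ {n} (w : Fin n) (f : Vector Carrier n) → ∑[ z < n ] when ⌊ w ≟ z ⌋ (f z) ≈ f w
  sum-delta {suc n} Fin.zero    f = trans (+-congˡ (sum-replicate-zero n)) (+-identityʳ _)
  sum-delta {suc n} (Fin.suc w) f = begin
    0# + ∑[ z < n ] when ⌊ Fin.suc w ≟ Fin.suc z ⌋ (f (Fin.suc z))
      ≡⟨ ≡.cong (0# +_) (sum-cong-≗ λ z → ≡.cong (λ t → when t (f (Fin.suc z))) (⌊⌋-map′ _ _ (w ≟ z))) ⟩
    0# + ∑[ z < n ] when ⌊ w ≟ z ⌋ (f (Fin.suc z))
      ≈⟨ +-identityˡ _ ⟩
    ∑[ z < n ] when ⌊ w ≟ z ⌋ (f (Fin.suc z))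
      ≈⟨ sum-delta w (f ∘ Fin.suc) ⟩
    f (Fin.suc w) ∎

  when-anyᵇ : ∀ {m} (p : Fin m → Bool) x → (∀ {i j} → T (p i) → T (p j) → i ≡ j) →
              when (anyᵇ m p) x ≈ ∑[ i < m ] when (p i) x
  when-anyᵇ {zero}  p x unique = refl
  when-anyᵇ {suc m} p x unique with p Fin.zero in p₀
  ... | true  = sym (trans (+-congˡ rest≈0) (+-identityʳ x))
    where
    rest≈0 : ∑[ i < m ] when (p (Fin.suc i)) x ≈ 0#
    rest≈0 = trans (sum-cong-≋ λ i → when-≈0# (p (Fin.suc i)) λ tᵢ →
                     ⊥-elim (0≢1+n (unique (≡.subst T (≡.sym p₀) _) tᵢ)))
                   (sum-replicate-zero m)
  ... | false = trans (when-anyᵇ (p ∘ Fin.suc) x (λ tᵢ tⱼ → suc-injective (unique tᵢ tⱼ)))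
                      (sym (+-identityˡ _))

  sum-image : ∀ {m n k} (c : Fin m → Fin n → Fin k) → Injective _≡_ _≡_ (uncurry c) →
              ∀ P Q (f : Vector Carrier k) →
              ∑[ z < k ] when (lookup (image c P Q) z) (f z)
                ≈ ∑[ a < m ] when (lookup P a) (∑[ b < n ] when (lookup (Q a) b) (f (c a b)))
  sum-image {m} {n} {k} c c-inj P Q f = begin
    ∑[ z < k ] when (lookup (image c P Q) z) (f z)
      ≡⟨ sum-cong-≗ (λ z → ≡.cong (λ t → when t (f z)) (lookup∘tabulate _ z)) ⟩
    ∑[ z < k ] when (anyᵇ m λ a → anyᵇ n λ b → hit a b z) (f z)
      ≈⟨ sum-cong-≋ (λ z → when-anyᵇ _ (f z) (first-unique z)) ⟩
    ∑[ z < k ] ∑[ a < m ] when (anyᵇ n λ b → hit a b z) (f z)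
      ≈⟨ sum-cong-≋ (λ z → sum-cong-≋ λ a → when-anyᵇ _ (f z) (second-unique z a)) ⟩
    ∑[ z < k ] ∑[ a < m ] ∑[ b < n ] when (hit a b z) (f z)
      ≈⟨ ∑-comm (λ z a → ∑[ b < n ] when (hit a b z) (f z)) ⟩
    ∑[ a < m ] ∑[ z < k ] ∑[ b < n ] when (hit a b z) (f z)
      ≈⟨ sum-cong-≋ (λ a → ∑-comm (λ z b → when (hit a b z) (f z))) ⟩
    ∑[ a < m ] ∑[ b < n ] ∑[ z < k ] when (hit a b z) (f z)
      ≈⟨ sum-cong-≋ (λ a → sum-cong-≋ λ b → collapse a b) ⟩
    ∑[ a < m ] ∑[ b < n ] when (lookup P a) (when (lookup (Q a) b) (f (c a b)))
      ≈⟨ sum-cong-≋ (λ a → sum-when (lookup P a) λ b → when (lookup (Q a) b) (f (c a b))) ⟩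
    ∑[ a < m ] when (lookup P a) (∑[ b < n ] when (lookup (Q a) b) (f (c a b))) ∎
    where
    hit : Fin m → Fin n → Fin k → Bool
    hit a b z = hitsᵇ c P Q z a b

    same-pair : ∀ {a b a′ b′ z} → T (hit a b z) → T (hit a′ b′ z) → (a , b) ≡ (a′ , b′)
    same-pair t t′ = c-inj (≡.trans (hitsᵇ⇒≡ c P Q t) (≡.sym (hitsᵇ⇒≡ c P Q t′)))

    first-unique : ∀ z {a a′} → T (anyᵇ n λ b → hit a b z) → T (anyᵇ n λ b → hit a′ b z) → a ≡ a′
    first-unique z t t′ =
      ,-injectiveˡ (same-pair (proj₂ (anyᵇ-witness (λ b → hit _ b z) t))
                              (proj₂ (anyᵇ-witness (λ b → hit _ b z) t′)))

    second-unique : ∀ z a {b b′} → T (hit a b z) → T (hit a b′ z) → b ≡ b′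
    second-unique z a t t′ = ,-injectiveʳ (same-pair t t′)

    collapse : ∀ a b → ∑[ z < k ] when (hit a b z) (f z)
                       ≈ when (lookup P a) (when (lookup (Q a) b) (f (c a b)))
    collapse a b = begin
      ∑[ z < k ] when (hit a b z) (f z)
        ≡⟨ sum-cong-≗ (λ z → ≡.trans (when-∧ (lookup P a) _ (f z))
                                (≡.cong (when (lookup P a)) (when-∧ (lookup (Q a) b) _ (f z)))) ⟩
      ∑[ z < k ] when (lookup P a) (when (lookup (Q a) b) (when ⌊ c a b ≟ z ⌋ (f z)))
        ≈⟨ sum-when (lookup P a) (λ z → when (lookup (Q a) b) (when ⌊ c a b ≟ z ⌋ (f z))) ⟩
      when (lookup P a) (∑[ z < k ] when (lookup (Q a) b) (when ⌊ c a b ≟ z ⌋ (f z)))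
        ≈⟨ when-congᵀ (lookup P a) (λ _ → sum-when (lookup (Q a) b) λ z → when ⌊ c a b ≟ z ⌋ (f z)) ⟩
      when (lookup P a) (when (lookup (Q a) b) (∑[ z < k ] when ⌊ c a b ≟ z ⌋ (f z)))
        ≈⟨ when-congᵀ (lookup P a) (λ _ → when-congᵀ (lookup (Q a) b) λ _ → sum-delta (c a b) f) ⟩
      when (lookup P a) (when (lookup (Q a) b) (f (c a b))) ∎

module Counting where
  open IndicatorSums ℕ.+-0-commutativeMonoid
  open import Algebra.Properties.CommutativeMonoid.Sum ℕ.+-0-commutativeMonoid
  open ≡.≡-Reasoning

  sum-when-lookup : ∀ {n} (S : Subset n) x → ∑[ i < n ] when (lookup S i) x ≡ ∣ S ∣ ℕ.* x
  sum-when-lookup []          x = ≡.refl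
  sum-when-lookup (true  ∷ S) x = ≡.cong (x ℕ.+_) (sum-when-lookup S x)
  sum-when-lookup (false ∷ S) x = sum-when-lookup S x

  ∣image∣ : ∀ {m n k} (c : Fin m → Fin n → Fin k) → Injective _≡_ _≡_ (uncurry c) →
            ∀ P Q {q} → (∀ a → a ∈ P → ∣ Q a ∣ ≡ q) → ∣ image c P Q ∣ ≡ ∣ P ∣ ℕ.* q
  ∣image∣ {m} {n} {k} c c-inj P Q {q} ∣Q∣≡q = begin
    ∣ image c P Q ∣
      ≡⟨ ≡.sym (ℕ.*-identityʳ _) ⟩
    ∣ image c P Q ∣ ℕ.* 1
      ≡⟨ ≡.sym (sum-when-lookup (image c P Q) 1) ⟩
    ∑[ z < k ] when (lookup (image c P Q) z) 1
      ≡⟨ sum-image c c-inj P Q (λ _ → 1) ⟩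
    ∑[ a < m ] when (lookup P a) (∑[ b < n ] when (lookup (Q a) b) 1)
      ≡⟨ sum-cong-≋ (λ a → when-congᵀ (lookup P a) λ a∈P → begin
           ∑[ b < n ] when (lookup (Q a) b) 1  ≡⟨ sum-when-lookup (Q a) 1 ⟩
           ∣ Q a ∣ ℕ.* 1                      ≡⟨ ℕ.*-identityʳ _ ⟩
           ∣ Q a ∣                            ≡⟨ ∣Q∣≡q a (T-lookup⇒∈ P a∈P) ⟩
           q                                  ∎) ⟩
    ∑[ a < m ] when (lookup P a) q
      ≡⟨ sum-when-lookup P q ⟩
    ∣ P ∣ ℕ.* q ∎

radix-< : ∀ {n m a b} → a < n → b < m → a ℕ.+ n ℕ.* b < n ℕ.* m
radix-< {n} {m} {a} {b} a<n b<m = begin-strict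
  a ℕ.+ n ℕ.* b  <⟨ ℕ.+-monoˡ-< (n ℕ.* b) a<n ⟩
  n ℕ.+ n ℕ.* b  ≡⟨ ℕ.*-suc n b ⟨
  n ℕ.* suc b    ≤⟨ ℕ.*-monoʳ-≤ n b<m ⟩
  n ℕ.* m        ∎
  where open ℕ.≤-Reasoning

radix-<′ : ∀ {n m a b} → a < m → b < n → m ℕ.* b ℕ.+ a < n ℕ.* m
radix-<′ {n} {m} {a} {b} a<m b<n =
  ≡.subst₂ _<_ (ℕ.+-comm a (m ℕ.* b)) (ℕ.*-comm m n) (radix-< a<m b<n)

radix-injective : ∀ n .{{_ : NonZero n}} {a a′ b b′} → a < n → a′ < n →
                  a ℕ.+ n ℕ.* b ≡ a′ ℕ.+ n ℕ.* b′ → a ≡ a′ × b ≡ b′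
radix-injective n {a} {a′} {b} {b′} a<n a′<n eq = a≡a′ , b≡b′
  where
  low-digit : ∀ {c} d → c < n → (c ℕ.+ n ℕ.* d) % n ≡ c
  low-digit {c} d c<n = ≡.trans (≡.cong (λ t → (c ℕ.+ t) % n) (ℕ.*-comm n d))
                        (≡.trans ([m+kn]%n≡m%n c d n) (m<n⇒m%n≡m c<n))
  a≡a′ : a ≡ a′
  a≡a′ = ≡.trans (≡.sym (low-digit b a<n)) (≡.trans (≡.cong (_% n) eq) (low-digit b′ a′<n))
  b≡b′ : b ≡ b′
  b≡b′ = ℕ.*-cancelˡ-≡ b b′ n (ℕ.+-cancelˡ-≡ a _ _ (≡.trans eq (≡.cong (ℕ._+ n ℕ.* b′) (≡.sym a≡a′))))

toℕ-[_] : ∀ {k} .{{_ : NonZero k}} n → n < k → toℕ ([ n ] k) ≡ n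
toℕ-[_] n n<k = ≡.trans (toℕ-fromℕ< _) (m<n⇒m%n≡m n<k)

module Digits (N M : ℕ) .{{_ : NonZero N}} .{{_ : NonZero M}} where

  private instance
    NM≢0 : NonZero (N ℕ.* M)
    NM≢0 = ℕ.m*n≢0 N M

  toUnion : Fin N → Fin M → Fin (N ℕ.* M)
  toUnion a b = [ toℕ a ℕ.+ N ℕ.* toℕ b ] (N ℕ.* M)

  toSpectrum : Fin N → Fin M → Fin (N ℕ.* M)
  toSpectrum l₁ l₂ = [ M ℕ.* toℕ l₁ ℕ.+ toℕ l₂ ] (N ℕ.* M)

  toℕ-toUnion : ∀ a b → toℕ (toUnion a b) ≡ toℕ a ℕ.+ N ℕ.* toℕ b
  toℕ-toUnion a b = toℕ-[ _ ] (radix-< (toℕ<n a) (toℕ<n b))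

  toℕ-toSpectrum : ∀ l₁ l₂ → toℕ (toSpectrum l₁ l₂) ≡ M ℕ.* toℕ l₁ ℕ.+ toℕ l₂
  toℕ-toSpectrum l₁ l₂ = toℕ-[ _ ] (radix-<′ (toℕ<n l₂) (toℕ<n l₁))

  toUnion-injective : Injective _≡_ _≡_ (uncurry toUnion)
  toUnion-injective {a , b} {a′ , b′} eq
    with radix-injective N (toℕ<n a) (toℕ<n a′)
           (≡.trans (≡.sym (toℕ-toUnion a b)) (≡.trans (≡.cong toℕ eq) (toℕ-toUnion a′ b′)))
  ... | a≡a′ , b≡b′ = ≡.cong₂ _,_ (toℕ-injective a≡a′) (toℕ-injective b≡b′)

  toSpectrum-injective : Injective _≡_ _≡_ (uncurry toSpectrum)
  toSpectrum-injective {l₁ , l₂} {l₁′ , l₂′} eq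
    with radix-injective M (toℕ<n l₂) (toℕ<n l₂′)
           (≡.trans (ℕ.+-comm (toℕ l₂) _)
           (≡.trans (≡.sym (toℕ-toSpectrum l₁ l₂))
           (≡.trans (≡.cong toℕ eq)
           (≡.trans (toℕ-toSpectrum l₁′ l₂′) (ℕ.+-comm _ (toℕ l₂′))))))
  ... | l₂≡l₂′ , l₁≡l₁′ = ≡.cong₂ _,_ (toℕ-injective l₁≡l₁′) (toℕ-injective l₂≡l₂′)

module RootsOfUnity (R : CommutativeRing 0ℓ 0ℓ) where
  open CommutativeRing R
  import Algebra.Properties.Semiring.Exp semiring as Exp
  open import Algebra.Solver.CommutativeMonoid *-commutativeMonoid using (solve; _⊕_; _⊜_)
  open import Data.Nat.Tactic.RingSolver using (solve-∀)
  open import Relation.Binary.Reasoning.Setoid setoid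

  infixr 8 _^_
  _^_ : Carrier → ℕ → Carrier
  x ^ n = pow R x n

  ^≡Exp^ : ∀ x n → x ^ n ≡ x Exp.^ n
  ^≡Exp^ x zero    = ≡.refl
  ^≡Exp^ x (suc n) = ≡.cong (x *_) (^≡Exp^ x n)

  ^-congˡ : ∀ n {x y} → x ≈ y → x ^ n ≈ y ^ n
  ^-congˡ zero    x≈y = refl
  ^-congˡ (suc n) x≈y = *-cong x≈y (^-congˡ n x≈y)

  ^-homo-* : ∀ x m n → x ^ (m ℕ.+ n) ≈ x ^ m * x ^ n
  ^-homo-* x m n rewrite ^≡Exp^ x (m ℕ.+ n) | ^≡Exp^ x m | ^≡Exp^ x n = Exp.^-homo-* x m n

  ^-assocʳ : ∀ x m n → (x ^ m) ^ n ≈ x ^ (m ℕ.* n)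
  ^-assocʳ x m n rewrite ^≡Exp^ (x ^ m) n | ^≡Exp^ x m | ^≡Exp^ x (m ℕ.* n) = Exp.^-assocʳ x m n

  1^n≈1 : ∀ n → 1# ^ n ≈ 1#
  1^n≈1 zero    = refl
  1^n≈1 (suc n) = trans (*-identityˡ _) (1^n≈1 n)

  inverse-unique : ∀ {u w v} → u * v ≈ 1# → w * v ≈ 1# → u ≈ w
  inverse-unique {u} {w} {v} uv≈1 wv≈1 = begin
    u            ≈⟨ *-identityʳ u ⟨
    u * 1#       ≈⟨ *-congˡ wv≈1 ⟨
    u * (w * v)  ≈⟨ solve 3 (λ u w v → u ⊕ (w ⊕ v) ⊜ w ⊕ (u ⊕ v)) refl u w v ⟩
    w * (u * v)  ≈⟨ *-congˡ uv≈1 ⟩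
    w * 1#       ≈⟨ *-identityʳ w ⟩
    w            ∎

  inverse-* : ∀ {u v u′ v′} → u * v ≈ 1# → u′ * v′ ≈ 1# → (u * u′) * (v * v′) ≈ 1#
  inverse-* {u} {v} {u′} {v′} uv≈1 u′v′≈1 = begin
    (u * u′) * (v * v′)  ≈⟨ solve 4 (λ u v u′ v′ → (u ⊕ u′) ⊕ (v ⊕ v′) ⊜ (u ⊕ v) ⊕ (u′ ⊕ v′)) refl u v u′ v′ ⟩
    (u * v) * (u′ * v′)  ≈⟨ *-cong uv≈1 u′v′≈1 ⟩
    1# * 1#              ≈⟨ *-identityʳ 1# ⟩
    1#                   ∎

  -- Summed over x ∈ X this is the (l, l′) entry of #X · U* U in Spectral: ω^(x(n ∸ l))
  -- stands for the complex conjugate of ω^(xl).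
  gramTerm : Carrier → ℕ → ℕ → ℕ → ℕ → Carrier
  gramTerm ω n l l′ x = ω ^ (x ℕ.* (n ∸ l)) * ω ^ (x ℕ.* l′)

  module _ (ω : Carrier) (n : ℕ) (ω^n≈1 : ω ^ n ≈ 1#) where

    ^-multiple≈1 : ∀ t → ω ^ (n ℕ.* t) ≈ 1#
    ^-multiple≈1 t = trans (sym (^-assocʳ ω n t)) (trans (^-congˡ t ω^n≈1) (1^n≈1 t))

    ^-periodic : ∀ t e → ω ^ (n ℕ.* t ℕ.+ e) ≈ ω ^ e
    ^-periodic t e = trans (^-homo-* ω (n ℕ.* t) e)
                           (trans (*-congʳ (^-multiple≈1 t)) (*-identityˡ (ω ^ e)))

    gramTerm-diagonal : ∀ {l} → l ≤ n → ∀ x → gramTerm ω n l l x ≈ 1#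
    gramTerm-diagonal {l} l≤n x = begin
      ω ^ (x ℕ.* (n ∸ l)) * ω ^ (x ℕ.* l)  ≈⟨ ^-homo-* ω (x ℕ.* (n ∸ l)) (x ℕ.* l) ⟨
      ω ^ (x ℕ.* (n ∸ l) ℕ.+ x ℕ.* l)      ≡⟨ ≡.cong (ω ^_) exponent ⟩
      ω ^ (n ℕ.* x)                        ≈⟨ ^-multiple≈1 x ⟩
      1#                                   ∎
      where
      exponent : x ℕ.* (n ∸ l) ℕ.+ x ℕ.* l ≡ n ℕ.* x
      exponent = ≡.trans (≡.sym (ℕ.*-distribˡ-+ x (n ∸ l) l))
                 (≡.trans (≡.cong (x ℕ.*_) (ℕ.m∸n+n≡m l≤n)) (ℕ.*-comm x n))

  module _ {N M : ℕ} {ζ : Carrier} (ζ^NM≈1 : ζ ^ (N ℕ.* M) ≈ 1#) where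

    private
      [ζ^M]^N≈1 : (ζ ^ M) ^ N ≈ 1#
      [ζ^M]^N≈1 = trans (^-assocʳ ζ M N) (trans (reflexive (≡.cong (ζ ^_) (ℕ.*-comm M N))) ζ^NM≈1)

      [ζ^N]^M≈1 : (ζ ^ N) ^ M ≈ 1#
      [ζ^N]^M≈1 = trans (^-assocʳ ζ N M) ζ^NM≈1

    ^-split : ∀ a b l l′ → ζ ^ ((a ℕ.+ N ℕ.* b) ℕ.* (M ℕ.* l ℕ.+ l′))
                           ≈ (ζ ^ M) ^ (a ℕ.* l) * ζ ^ (a ℕ.* l′) * (ζ ^ N) ^ (b ℕ.* l′)
    ^-split a b l l′ = begin
      ζ ^ ((a ℕ.+ N ℕ.* b) ℕ.* (M ℕ.* l ℕ.+ l′))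
        ≡⟨ ≡.cong (ζ ^_) (expand N M a b l l′) ⟩
      ζ ^ (N ℕ.* M ℕ.* (b ℕ.* l) ℕ.+ (M ℕ.* (a ℕ.* l) ℕ.+ a ℕ.* l′ ℕ.+ N ℕ.* (b ℕ.* l′)))
        ≈⟨ ^-periodic ζ (N ℕ.* M) ζ^NM≈1 (b ℕ.* l) (M ℕ.* (a ℕ.* l) ℕ.+ a ℕ.* l′ ℕ.+ N ℕ.* (b ℕ.* l′)) ⟩
      ζ ^ (M ℕ.* (a ℕ.* l) ℕ.+ a ℕ.* l′ ℕ.+ N ℕ.* (b ℕ.* l′))
        ≈⟨ trans (^-homo-* ζ (M ℕ.* (a ℕ.* l) ℕ.+ a ℕ.* l′) (N ℕ.* (b ℕ.* l′)))
                 (*-congʳ (^-homo-* ζ (M ℕ.* (a ℕ.* l)) (a ℕ.* l′))) ⟩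
      ζ ^ (M ℕ.* (a ℕ.* l)) * ζ ^ (a ℕ.* l′) * ζ ^ (N ℕ.* (b ℕ.* l′))
        ≈⟨ *-cong (*-congʳ (^-assocʳ ζ M (a ℕ.* l))) (^-assocʳ ζ N (b ℕ.* l′)) ⟨
      (ζ ^ M) ^ (a ℕ.* l) * ζ ^ (a ℕ.* l′) * (ζ ^ N) ^ (b ℕ.* l′) ∎
      where
      expand : ∀ N M a b l l′ → (a ℕ.+ N ℕ.* b) ℕ.* (M ℕ.* l ℕ.+ l′)
               ≡ N ℕ.* M ℕ.* (b ℕ.* l) ℕ.+ (M ℕ.* (a ℕ.* l) ℕ.+ a ℕ.* l′ ℕ.+ N ℕ.* (b ℕ.* l′))
      expand = solve-∀

    ^-∸-split : ∀ {l l′} → l < N → l′ < M → ∀ a b →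
                ζ ^ ((a ℕ.+ N ℕ.* b) ℕ.* (N ℕ.* M ∸ (M ℕ.* l ℕ.+ l′)))
                  ≈ (ζ ^ M) ^ (a ℕ.* (N ∸ l)) * ζ ^ (a ℕ.* (N ℕ.* M ∸ l′)) * (ζ ^ N) ^ (b ℕ.* (M ∸ l′))
    -- Both sides are inverses of ζ ^ ((a + N b)(M l + l′)), factored by ^-split.
    ^-∸-split {l} {l′} l<N l′<M a b =
      inverse-unique (gramTerm-diagonal ζ (N ℕ.* M) ζ^NM≈1 (ℕ.<⇒≤ λ<NM) (a ℕ.+ N ℕ.* b))
        (trans (*-congˡ (^-split a b l l′))
               (inverse-* (inverse-* (gramTerm-diagonal (ζ ^ M) N [ζ^M]^N≈1 (ℕ.<⇒≤ l<N) a)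
                                     (gramTerm-diagonal ζ (N ℕ.* M) ζ^NM≈1 l′≤NM a))
                          (gramTerm-diagonal (ζ ^ N) M [ζ^N]^M≈1 (ℕ.<⇒≤ l′<M) b)))
      where
      λ<NM : M ℕ.* l ℕ.+ l′ < N ℕ.* M
      λ<NM = radix-<′ l′<M l<N
      l′≤NM : l′ ≤ N ℕ.* M
      l′≤NM = ℕ.≤-trans (ℕ.m≤n+m l′ (M ℕ.* l)) (ℕ.<⇒≤ λ<NM)

    gramTerm-split : ∀ {l₁ l₂} → l₁ < N → l₂ < M → ∀ l₁′ l₂′ a b →
      gramTerm ζ (N ℕ.* M) (M ℕ.* l₁ ℕ.+ l₂) (M ℕ.* l₁′ ℕ.+ l₂′) (a ℕ.+ N ℕ.* b)
        ≈ gramTerm (ζ ^ M) N l₁ l₁′ a * gramTerm ζ (N ℕ.* M) l₂ l₂′ a * gramTerm (ζ ^ N) M l₂ l₂′ b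
    gramTerm-split {l₁} {l₂} l₁<N l₂<M l₁′ l₂′ a b =
      trans (*-cong (^-∸-split l₁<N l₂<M a b) (^-split a b l₁′ l₂′))
            (solve 6 (λ g h k g′ h′ k′ → ((g ⊕ h) ⊕ k) ⊕ ((g′ ⊕ h′) ⊕ k′)
                                        ⊜ ((g ⊕ g′) ⊕ (h ⊕ h′)) ⊕ (k ⊕ k′))
                   refl ((ζ ^ M) ^ (a ℕ.* (N ∸ l₁))) (ζ ^ (a ℕ.* (N ℕ.* M ∸ l₂))) ((ζ ^ N) ^ (b ℕ.* (M ∸ l₂)))
                        ((ζ ^ M) ^ (a ℕ.* l₁′)) (ζ ^ (a ℕ.* l₂′)) ((ζ ^ N) ^ (b ℕ.* l₂′)))

module SubsetSums (R : CommutativeRing 0ℓ 0ℓ) where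
  open CommutativeRing R
  open import Algebra.Properties.Semiring.Sum semiring using (sum; sum-syntax; sum-cong-≋; *-distribˡ-sum; *-distribʳ-sum)
  import Algebra.Properties.Semiring.Mult semiring as Mult
  open IndicatorSums +-commutativeMonoid using (when)

  ΣFin≡sum : ∀ K (f : Fin K → Carrier) → ΣFin R K f ≡ sum f
  ΣFin≡sum zero    f = ≡.refl
  ΣFin≡sum (suc K) f = ≡.cong (f Fin.zero +_) (ΣFin≡sum K (f ∘ Fin.suc))

  ΣSub≡sum : ∀ {K} (X : Subset K) f → ΣSub R X f ≡ ∑[ x < K ] when (lookup X x) (f x)
  ΣSub≡sum {K} X f = ΣFin≡sum K _

  natR≡×1# : ∀ n → natR R n ≡ n Mult.× 1#
  natR≡×1# zero    = ≡.refl
  natR≡×1# (suc n) = ≡.cong (1# +_) (natR≡×1# n)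

  natR-homo-* : ∀ m n → natR R (m ℕ.* n) ≈ natR R m * natR R n
  natR-homo-* m n rewrite natR≡×1# (m ℕ.* n) | natR≡×1# m | natR≡×1# n = Mult.×1-homo-* m n

  when-*ˡ : ∀ b c x → c * when b x ≈ when b (c * x)
  when-*ˡ true  c x = refl
  when-*ˡ false c x = zeroʳ c

  when-*ʳ : ∀ b c x → when b x * c ≈ when b (x * c)
  when-*ʳ true  c x = refl
  when-*ʳ false c x = zeroˡ c

  sum-when-*ˡ : ∀ {n} (p : Fin n → Bool) c (f : Fin n → Carrier) →
                c * ∑[ i < n ] when (p i) (f i) ≈ ∑[ i < n ] when (p i) (c * f i)
  sum-when-*ˡ p c f = trans (*-distribˡ-sum c λ i → when (p i) (f i)) (sum-cong-≋ λ i → when-*ˡ (p i) c (f i))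

  sum-when-*ʳ : ∀ {n} (p : Fin n → Bool) c (f : Fin n → Carrier) →
                (∑[ i < n ] when (p i) (f i)) * c ≈ ∑[ i < n ] when (p i) (f i * c)
  sum-when-*ʳ p c f = trans (*-distribʳ-sum c λ i → when (p i) (f i)) (sum-cong-≋ λ i → when-*ʳ (p i) c (f i))

module _ (N M : ℕ) .{{_ : NonZero N}} .{{_ : NonZero M}} (R : CommutativeRing 0ℓ 0ℓ)
         (ζ : CommutativeRing.Carrier R) where
  open CommutativeRing R
  open import Algebra.Properties.Semiring.Sum semiring using (sum-syntax; sum-cong-≋; sum-replicate-zero)
  open import Relation.Binary.Reasoning.Setoid setoid
  open IndicatorSums +-commutativeMonoid using (when; when-congᵀ; when-≈0#; when-∧; sum-image)
  open RootsOfUnity R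
  open SubsetSums R
  open Digits N M
  open Counting using (∣image∣)

  private
    K = N ℕ.* M

  -- Only ζ ^ (N M) ≈ 1# is needed: cardinalities are compared in ℕ, so neither primitivity
  -- of ζ nor characteristic zero plays a role. Note that bigUnion N M A Aa and
  -- sumSpectrum N M Λ₁ Λ₂ unfold to image toUnion A Aa and image toSpectrum Λ₁ (λ _ → Λ₂).
  spectral-bigUnion : ζ ^ K ≈ 1# →
    (A Λ₁ : Subset N) (Aa : Fin N → Subset M) (Λ₂ : Subset M) →
    Spectral R N (ζ ^ M) A Λ₁ →
    (∀ a → a ∈ A → Spectral R M (ζ ^ N) (Aa a) Λ₂) →
    Spectral R K ζ (bigUnion N M A Aa) (sumSpectrum N M Λ₁ Λ₂)
  spectral-bigUnion ζ^K≈1 A Λ₁ Aa Λ₂ (∣Λ₁∣≡∣A∣ , A-orth) Aa-spectral = ∣Λ∣≡∣X∣ , orth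
    where
    X = bigUnion N M A Aa
    Λ = sumSpectrum N M Λ₁ Λ₂
    ∣Λ₂∣ᴿ = natR R ∣ Λ₂ ∣

    ∣X∣≡ : ∣ X ∣ ≡ ∣ A ∣ ℕ.* ∣ Λ₂ ∣
    ∣X∣≡ = ∣image∣ toUnion toUnion-injective A Aa λ a a∈A → ≡.sym (proj₁ (Aa-spectral a a∈A))

    ∣Λ∣≡∣X∣ : ∣ Λ ∣ ≡ ∣ X ∣
    ∣Λ∣≡∣X∣ = ≡.trans (∣image∣ toSpectrum toSpectrum-injective Λ₁ (λ _ → Λ₂) (λ _ _ → ≡.refl))
                      (≡.trans (≡.cong (ℕ._* ∣ Λ₂ ∣) ∣Λ₁∣≡∣A∣) (≡.sym ∣X∣≡))

    module Entry {l₁ l₂ l₁′ l₂′} (l₁∈Λ₁ : l₁ ∈ Λ₁) (l₂∈Λ₂ : l₂ ∈ Λ₂) (l₁′∈Λ₁ : l₁′ ∈ Λ₁) (l₂′∈Λ₂ : l₂′ ∈ Λ₂) where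
      F : Fin K → Carrier
      F z = gramTerm ζ K (toℕ (toSpectrum l₁ l₂)) (toℕ (toSpectrum l₁′ l₂′)) (toℕ z)
      G : Fin N → Carrier
      G a = gramTerm (ζ ^ M) N (toℕ l₁) (toℕ l₁′) (toℕ a)
      H : Fin N → Carrier
      H a = gramTerm ζ K (toℕ l₂) (toℕ l₂′) (toℕ a)
      B : Fin M → Carrier
      B b = gramTerm (ζ ^ N) M (toℕ l₂) (toℕ l₂′) (toℕ b)

      F-split : ∀ a b → F (toUnion a b) ≈ G a * H a * B b
      F-split a b = begin
        F (toUnion a b)
          ≡⟨ ≡.cong₂ (λ u v → gramTerm ζ K u v (toℕ (toUnion a b)))
                     (toℕ-toSpectrum l₁ l₂) (toℕ-toSpectrum l₁′ l₂′) ⟩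
        gramTerm ζ K (M ℕ.* toℕ l₁ ℕ.+ toℕ l₂) (M ℕ.* toℕ l₁′ ℕ.+ toℕ l₂′) (toℕ (toUnion a b))
          ≡⟨ ≡.cong (gramTerm ζ K (M ℕ.* toℕ l₁ ℕ.+ toℕ l₂) (M ℕ.* toℕ l₁′ ℕ.+ toℕ l₂′)) (toℕ-toUnion a b) ⟩
        gramTerm ζ K (M ℕ.* toℕ l₁ ℕ.+ toℕ l₂) (M ℕ.* toℕ l₁′ ℕ.+ toℕ l₂′) (toℕ a ℕ.+ N ℕ.* toℕ b)
          ≈⟨ gramTerm-split ζ^K≈1 (toℕ<n l₁) (toℕ<n l₂) (toℕ l₁′) (toℕ l₂′) (toℕ a) (toℕ b) ⟩
        G a * H a * B b ∎

      column : ∀ a → T (lookup A a) →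
               ∑[ b < M ] when (lookup (Aa a) b) (F (toUnion a b)) ≈ G a * H a * when ⌊ l₂ ≟ l₂′ ⌋ ∣Λ₂∣ᴿ
      column a a∈A = begin
        ∑[ b < M ] when (lookup (Aa a) b) (F (toUnion a b))
          ≈⟨ sum-cong-≋ (λ b → when-congᵀ (lookup (Aa a) b) λ _ → F-split a b) ⟩
        ∑[ b < M ] when (lookup (Aa a) b) (G a * H a * B b)
          ≈⟨ sum-when-*ˡ (lookup (Aa a)) (G a * H a) B ⟨
        G a * H a * ∑[ b < M ] when (lookup (Aa a) b) (B b)
          ≡⟨ ≡.cong (G a * H a *_) (≡.sym (ΣSub≡sum (Aa a) B)) ⟩
        G a * H a * ΣSub R (Aa a) B
          ≈⟨ *-congˡ (proj₂ spectral l₂ l₂′ l₂∈Λ₂ l₂′∈Λ₂) ⟩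
        G a * H a * when ⌊ l₂ ≟ l₂′ ⌋ (natR R ∣ Aa a ∣)
          ≡⟨ ≡.cong (λ n → G a * H a * when ⌊ l₂ ≟ l₂′ ⌋ (natR R n)) (≡.sym (proj₁ spectral)) ⟩
        G a * H a * when ⌊ l₂ ≟ l₂′ ⌋ ∣Λ₂∣ᴿ ∎
        where spectral = Aa-spectral a (T-lookup⇒∈ A a∈A)

      rows : ∑[ a < N ] when (lookup A a) (G a * H a * when ⌊ l₂ ≟ l₂′ ⌋ ∣Λ₂∣ᴿ)
             ≈ when ⌊ l₁ ≟ l₁′ ⌋ (when ⌊ l₂ ≟ l₂′ ⌋ (natR R ∣ X ∣))
      rows with l₂ ≟ l₂′
      ... | no _ = begin
        ∑[ a < N ] when (lookup A a) (G a * H a * 0#)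
          ≈⟨ sum-cong-≋ (λ a → when-≈0# (lookup A a) λ _ → zeroʳ (G a * H a)) ⟩
        ∑[ a < N ] 0#
          ≈⟨ sum-replicate-zero N ⟩
        0#
          ≈⟨ when-≈0# ⌊ l₁ ≟ l₁′ ⌋ (λ _ → refl) ⟨
        when ⌊ l₁ ≟ l₁′ ⌋ 0# ∎
      ... | yes ≡.refl = begin
        ∑[ a < N ] when (lookup A a) (G a * H a * ∣Λ₂∣ᴿ)
          ≈⟨ sum-cong-≋ (λ a → when-congᵀ (lookup A a) λ _ → *-congʳ (trans (*-congˡ (H≈1 a)) (*-identityʳ (G a)))) ⟩
        ∑[ a < N ] when (lookup A a) (G a * ∣Λ₂∣ᴿ)
          ≈⟨ sum-when-*ʳ (lookup A) ∣Λ₂∣ᴿ G ⟨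
        (∑[ a < N ] when (lookup A a) (G a)) * ∣Λ₂∣ᴿ
          ≡⟨ ≡.cong (_* ∣Λ₂∣ᴿ) (≡.sym (ΣSub≡sum A G)) ⟩
        ΣSub R A G * ∣Λ₂∣ᴿ
          ≈⟨ *-congʳ (A-orth l₁ l₁′ l₁∈Λ₁ l₁′∈Λ₁) ⟩
        when ⌊ l₁ ≟ l₁′ ⌋ (natR R ∣ A ∣) * ∣Λ₂∣ᴿ
          ≈⟨ when-*ʳ ⌊ l₁ ≟ l₁′ ⌋ ∣Λ₂∣ᴿ (natR R ∣ A ∣) ⟩
        when ⌊ l₁ ≟ l₁′ ⌋ (natR R ∣ A ∣ * ∣Λ₂∣ᴿ)
          ≈⟨ when-congᵀ ⌊ l₁ ≟ l₁′ ⌋ (λ _ → natR∣X∣≈) ⟨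
        when ⌊ l₁ ≟ l₁′ ⌋ (natR R ∣ X ∣) ∎
        where
        natR∣X∣≈ : natR R ∣ X ∣ ≈ natR R ∣ A ∣ * ∣Λ₂∣ᴿ
        natR∣X∣≈ = trans (reflexive (≡.cong (natR R) ∣X∣≡)) (natR-homo-* ∣ A ∣ ∣ Λ₂ ∣)
        H≈1 : ∀ a → H a ≈ 1#
        H≈1 a = gramTerm-diagonal ζ K ζ^K≈1 (ℕ.≤-trans (ℕ.<⇒≤ (toℕ<n l₂)) (ℕ.m≤n*m M N)) (toℕ a)

      orthogonal : ΣSub R X F ≈ when ⌊ toSpectrum l₁ l₂ ≟ toSpectrum l₁′ l₂′ ⌋ (natR R ∣ X ∣)
      orthogonal = begin
        ΣSub R X F
          ≡⟨ ΣSub≡sum X F ⟩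
        ∑[ z < K ] when (lookup X z) (F z)
          ≈⟨ sum-image toUnion toUnion-injective A Aa F ⟩
        ∑[ a < N ] when (lookup A a) (∑[ b < M ] when (lookup (Aa a) b) (F (toUnion a b)))
          ≈⟨ sum-cong-≋ (λ a → when-congᵀ (lookup A a) (column a)) ⟩
        ∑[ a < N ] when (lookup A a) (G a * H a * when ⌊ l₂ ≟ l₂′ ⌋ ∣Λ₂∣ᴿ)
          ≈⟨ rows ⟩
        when ⌊ l₁ ≟ l₁′ ⌋ (when ⌊ l₂ ≟ l₂′ ⌋ (natR R ∣ X ∣))
          ≡⟨ ≡.sym (when-∧ ⌊ l₁ ≟ l₁′ ⌋ _ _) ⟩
        when (⌊ l₁ ≟ l₁′ ⌋ ∧ ⌊ l₂ ≟ l₂′ ⌋) (natR R ∣ X ∣)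
          ≡⟨ ≡.cong (λ t → when t (natR R ∣ X ∣)) (⌊≟⌋-injective₂ toSpectrum toSpectrum-injective l₁ l₂ l₁′ l₂′) ⟨
        when ⌊ toSpectrum l₁ l₂ ≟ toSpectrum l₁′ l₂′ ⌋ (natR R ∣ X ∣) ∎

    orth : ∀ μ ν → μ ∈ Λ → ν ∈ Λ →
           ΣSub R X (λ x → gramTerm ζ K (toℕ μ) (toℕ ν) (toℕ x)) ≈ when ⌊ μ ≟ ν ⌋ (natR R ∣ X ∣)
    orth μ ν μ∈Λ ν∈Λ
      with image-preimage toSpectrum Λ₁ (λ _ → Λ₂) μ∈Λ | image-preimage toSpectrum Λ₁ (λ _ → Λ₂) ν∈Λ
    ... | l₁ , l₂ , l₁∈ , l₂∈ , ≡.refl | l₁′ , l₂′ , l₁′∈ , l₂′∈ , ≡.refl = Entry.orthogonal l₁∈ l₂∈ l₁′∈ l₂′∈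

open import Data.Nat using (_*_)

corollary4p9 : (N M : ℕ) .{{_ : NonZero N}} .{{_ : NonZero M}}
    (R : CommutativeRing 0ℓ 0ℓ) → IsChar0Domain R →
    (ζ : CommutativeRing.Carrier R) → IsPrimitiveRoot R (N * M) ζ →
    (A Λ₁ : Subset N) (Aa : Fin N → Subset M) (Λ₂ : Subset M) →
    Spectral R N (pow R ζ M) A Λ₁ →
    (∀ a → a ∈ A → Spectral R M (pow R ζ N) (Aa a) Λ₂) →
    Spectral R (N * M) ζ (bigUnion N M A Aa) (sumSpectrum N M Λ₁ Λ₂)
corollary4p9 N M R _ ζ (ζ^NM≈1 , _) = spectral-bigUnion N M R ζ ζ^NM≈1
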